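{- Let $G$ be a finite graph with a vertex $A$ such that the sages win the hat guessing game on $G$ with the hint $A-1$. Let $G'$ be the graph obtained from $G$ by adding a new vertex $B$ and a single edge $AB$. Then the sages win the hat guessing game on $G'$ with the hint $B-1$.
   Context: Hat guessing game: a sage sits at each vertex of a finite graph; hat colors are $H=\{0,1,2\}$; each sage sees only his neighbours' hats and guesses his own color by a deterministic function of the neighbours' colors, fixed in advance. Hint $X-1$ for a vertex $X$: a color $i\in H$ is announced in advance to everyone and only placements $C$ with $C(X)\ne i$ occur. The sages win with the hint $X-1$ if for every announced color $i$ there is a strategy such that every hat placement $C$ with $C(X)\neq i$ has at least one correct guess (by permuting color names, equivalent to this for a single $i$). -}

module Defs where

open import Data.Nat using (ℕ; suc)
open import Data.Fin using (Fin; zero; suc; fromℕ; inject₁)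
open import Data.Bool using (Bool; true; false)
open import Data.Product using (Σ; ∃; _×_; _,_)
open import Relation.Binary.PropositionalEquality using (_≡_; refl)
open import Data.Fin using (_≟_)
open import Relation.Nullary.Decidable using (⌊_⌋)
open import Relation.Nullary using (¬_)

record Graph (n : ℕ) : Set where
  field
    adj   : Fin n → Fin n → Bool
    sym   : ∀ u v → adj u v ≡ adj v u
    irrefl : ∀ v → adj v v ≡ false
open Graph public

Colour : Set
Colour = Fin 3

Placement : ℕ → Set
Placement n = Fin n → Colour

AgreeOnNbhd : ∀ {n} → Graph n → Fin n → Placement n → Placement n → Set
AgreeOnNbhd G v C D = ∀ u → adj G v u ≡ true → C u ≡ D u

record Strategy {n : ℕ} (G : Graph n) : Set where
  field
    guess : Fin n → Placement n → Colour
    local : ∀ v C D → AgreeOnNbhd G v C D → guess v C ≡ guess v D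
open Strategy public

-- The sages win with the hint X-1: for every announced colour i there is a
-- strategy such that every placement C with C X ≠ i has a correct guess.
WinsWithHint : ∀ {n} → Graph n → Fin n → Set
WinsWithHint {n} G X =
  ∀ (i : Colour) → Σ (Strategy G) λ S →
    ∀ (C : Placement n) → ¬ (C X ≡ i) → ∃ λ v → guess S v C ≡ C v

-- G' : add a new vertex B, placed at index zero of Fin (suc n), joined by
-- a single edge to A; the old vertex v of G becomes suc v.
isA : ∀ {n} → Fin n → Fin n → Bool
isA A v = ⌊ v ≟ A ⌋

extAdj : ∀ {n} → Graph n → Fin n → Fin (suc n) → Fin (suc n) → Bool
extAdj G A zero    zero    = false
extAdj G A zero    (suc v) = isA A v
extAdj G A (suc u) zero    = isA A u
extAdj G A (suc u) (suc v) = adj G u v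

extAdj-sym : ∀ {n} (G : Graph n) (A : Fin n) u v → extAdj G A u v ≡ extAdj G A v u
extAdj-sym G A zero    zero    = refl
extAdj-sym G A zero    (suc v) = refl
extAdj-sym G A (suc u) zero    = refl
extAdj-sym G A (suc u) (suc v) = sym G u v

extAdj-irrefl : ∀ {n} (G : Graph n) (A : Fin n) v → extAdj G A v v ≡ false
extAdj-irrefl G A zero    = refl
extAdj-irrefl G A (suc v) = irrefl G v

addPendant : ∀ {n} → Graph n → Fin n → Graph (suc n)
addPendant G A = record
  { adj = extAdj G A ; sym = extAdj-sym G A ; irrefl = extAdj-irrefl G A }

newVertex : ∀ {n} → Fin (suc n)
newVertex = zero

module Submission where

open import Defs hiding (sym)
open import Data.Nat using (ℕ; suc)
open import Data.Fin using (Fin; zero; suc; _≟_; punchIn; punchOut)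
open import Data.Fin.Properties using (punchIn-punchOut)
open import Data.Bool using (true; false; if_then_else_)
open import Data.Product using (∃; _,_; proj₁; proj₂)
open import Function using (_∘_)
open import Relation.Binary.PropositionalEquality using (_≡_; _≢_; refl; sym; trans)
open import Relation.Nullary using (yes; no; does; contradiction)
open import Relation.Nullary.Decidable using (isYes≗does; dec-true; dec-false)

-- Let i be the forbidden colour of B and x, y the two other colours.  B
-- guesses x if A wears i and y otherwise; A guesses i if B wears y and
-- otherwise plays his strategy for G, as does everyone else.  If B wears y,
-- then A (when A wears i) or B (when not) is right; if B wears x and A wears
-- i, B is right; in the remaining case A does not wear i and the winning
-- strategy for G with the hint A-1 applies.

punchIn-cover : ∀ {i c : Fin 3} → c ≢ i → c ≢ punchIn i (suc zero) → c ≡ punchIn i zero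
punchIn-cover {i} {c} c≢i c≢y = cover (punchOut (c≢i ∘ sym)) (punchIn-punchOut (c≢i ∘ sym))
  where
  cover : (j : Fin 2) → punchIn i j ≡ c → c ≡ punchIn i zero
  cover zero       i,j≡c = sym i,j≡c
  cover (suc zero) i,j≡c = contradiction (sym i,j≡c) c≢y

isA-refl : ∀ {n} (A : Fin n) → isA A A ≡ true
isA-refl A = trans (isYes≗does (A ≟ A)) (dec-true (A ≟ A) refl)

module PendantStrategy {n : ℕ} (G : Graph n) (A : Fin n) (i : Colour) (S : Strategy G) where

  G′ : Graph (suc n)
  G′ = addPendant G A

  x y : Colour
  x = punchIn i zero
  y = punchIn i (suc zero)

  restrict : Placement (suc n) → Placement n
  restrict C = C ∘ suc

  guessB : Colour → Colour
  guessB a = if does (a ≟ i) then x else y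

  guessA : Colour → Colour → Colour
  guessA b old = if does (b ≟ y) then i else old

  guessB-≡ : ∀ {a} → a ≡ i → guessB a ≡ x
  guessB-≡ {a} a≡i rewrite dec-true (a ≟ i) a≡i = refl

  guessB-≢ : ∀ {a} → a ≢ i → guessB a ≡ y
  guessB-≢ {a} a≢i rewrite dec-false (a ≟ i) a≢i = refl

  guessA-≡ : ∀ {b} old → b ≡ y → guessA b old ≡ i
  guessA-≡ {b} old b≡y rewrite dec-true (b ≟ y) b≡y = refl

  guessA-≢ : ∀ {b} old → b ≢ y → guessA b old ≡ old
  guessA-≢ {b} old b≢y rewrite dec-false (b ≟ y) b≢y = refl

  guess′ : Fin (suc n) → Placement (suc n) → Colour
  guess′ zero    C = guessB (C (suc A))
  guess′ (suc v) C = if isA A v then guessA (C zero) old else old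
    where old = guess S v (restrict C)

  local-old : ∀ v C D → AgreeOnNbhd G′ (suc v) C D →
              guess S v (restrict C) ≡ guess S v (restrict D)
  local-old v C D agree = local S v _ _ (agree ∘ suc)

  local′ : ∀ v C D → AgreeOnNbhd G′ v C D → guess′ v C ≡ guess′ v D
  local′ zero C D agree rewrite agree (suc A) (isA-refl A) = refl
  local′ (suc v) C D agree with isA A v in adjB
  ... | false = local-old v C D agree
  ... | true rewrite agree zero adjB | local-old v C D agree = refl

  S′ : Strategy G′
  S′ = record { guess = guess′ ; local = local′ }

  guess′-A : ∀ C → guess′ (suc A) C ≡ guessA (C zero) (guess S A (restrict C))
  guess′-A C rewrite isA-refl A = refl

  guess′-old : ∀ v C → C zero ≢ y → guess′ (suc v) C ≡ guess S v (restrict C)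
  guess′-old v C B≢y with isA A v
  ... | true  = guessA-≢ _ B≢y
  ... | false = refl

  S′-wins : (∀ C → C A ≢ i → ∃ λ v → guess S v C ≡ C v) →
            ∀ C → C zero ≢ i → ∃ λ v → guess′ v C ≡ C v
  S′-wins S-wins C B≢i with C zero ≟ y | C (suc A) ≟ i
  ... | yes B≡y | yes A≡i = suc A , trans (guess′-A C) (trans (guessA-≡ _ B≡y) (sym A≡i))
  ... | yes B≡y | no  A≢i = zero , trans (guessB-≢ A≢i) (sym B≡y)
  ... | no  B≢y | yes A≡i = zero , trans (guessB-≡ A≡i) (sym (punchIn-cover B≢i B≢y))
  ... | no  B≢y | no  A≢i with S-wins (restrict C) A≢i
  ...   | v , correct = suc v , trans (guess′-old v C B≢y) correct

lemma10 : (n : ℕ) (G : Graph n) (A : Fin n) →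
    WinsWithHint G A →
    WinsWithHint (addPendant G A) (newVertex {n})
lemma10 n G A wins i = S′ , S′-wins (proj₂ (wins i))
  where open PendantStrategy G A i (proj₁ (wins i))
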